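{- Let $p$ be a prime number and let $A_1, A_2 \subseteq \mathbb{Z}_p$ be any sets with $|A_1|\,|A_2| \ge 20p$. Then there exist $x, y \in \mathbb{Z}_p$ such that $x+y \in A_1$ and $xy \in A_2$.
   Context: $\mathbb{Z}_p = \mathbb{Z}/p\mathbb{Z}$. -}

module Defs where

open import Data.Nat using (ℕ; NonZero)
open import Data.Nat.DivMod using (_mod_)
open import Data.Fin using (Fin; toℕ)
import Data.Nat as ℕ

addMod : (q : ℕ) → .{{NonZero q}} → Fin q → Fin q → Fin q
addMod q x y = (toℕ x ℕ.+ toℕ y) mod q

mulMod : (q : ℕ) → .{{NonZero q}} → Fin q → Fin q → Fin q
mulMod q x y = (toℕ x ℕ.* toℕ y) mod q

-- If no x, y work, let r(t) count the pairs (x, y) with x + y ∈ A₁ and x y = t. Then ∑ r = p |A₁| and r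
-- vanishes on A₂, so by Cauchy–Schwarz (p |A₁|)² ≤ (p − |A₂|) ∑ r². The energy ∑ r² counts the solutions of
-- x (s − x) = x' (s' − x') with s, s' ∈ A₁. Writing x' = x + k the equation is linear in x with slope
-- s' − s − 2k, which vanishes for at most one k (p is odd), and in the degenerate case forces s' ≡ ±s. So each
-- pair (s, s') has at most p solutions, plus p for each sign with s' ≡ ±s, and ∑ r² ≤ |A₁| (|A₁| + 2) p.
-- Together these give |A₁| |A₂| ≤ 2p < 20p; the hypothesis forces p ≥ 20, so p is indeed odd.

module Submission where

open import Data.Bool.Base using (if_then_else_)
open import Data.Empty using (⊥-elim)
open import Data.Fin.Base using (Fin; zero; suc; toℕ)
open import Data.Fin.Permutation using (Permutation′; permutation)
open import Data.Fin.Properties using (_≟_; any?)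
import Data.Fin.Properties as Fin
open import Data.Nat.Base using (ℕ; NonZero)
open import Data.Nat.Primality using (Prime; prime⇒nonZero)
open import Data.Product using (∃₂; _×_; _,_)
open import Data.Sum.Base using (_⊎_)
import Data.Sum.Base as Sum
open import Data.Vec.Base using ([]; _∷_)
open import Function.Base using (_∘_)
open import Level using (0ℓ)
open import Relation.Binary.Bundles using (Setoid)
open import Relation.Binary.PropositionalEquality
  using (_≡_; refl; sym; trans; cong; cong₂; subst; subst₂; module ≡-Reasoning)
open import Relation.Nullary using (¬_; Dec; does; yes; no)
open import Relation.Nullary.Decidable using (_×-dec_; decidable-stable)
open import Defs

module ModularArithmetic (p : ℕ) (prime : Prime p) where
  open import Data.Fin.Properties using (toℕ-injective; toℕ<n; toℕ-fromℕ<)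
  open import Data.Integer.Base using (ℤ; +_; _+_; _*_; -_; _-_; _⊖_; ∣_∣; 0ℤ)
  open import Data.Integer.Divisibility.Signed
    using (_∣_; divides; _∣?_; ∣m∣n⇒∣m+n; ∣m⇒∣-m; ∣n⇒∣m*n; ∣⇒∣ᵤ; ∣ᵤ⇒∣)
  import Data.Integer.Properties as ℤ
  open import Data.Integer.Tactic.RingSolver using (solve-∀)
  import Data.Nat.Base as ℕ
  open import Data.Nat.DivMod using (_mod_; _%_; _/_; m≡m%n+[m/n]*n; m<n⇒m%n≡m)
  import Data.Nat.Divisibility as ℕ
  open import Data.Nat.Primality using (euclidsLemma)
  import Data.Nat.Properties as ℕ
  import Relation.Binary.Reasoning.Setoid as ≈-Reasoning
  import Relation.Nullary.Decidable as Dec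

  instance
    p≢0 : NonZero p
    p≢0 = prime⇒nonZero prime

  infix 4 _≈_ _≉_ _≈?_

  -- Congruence modulo p, as a record so that i and j can be inferred from a proof.
  record _≈_ (i j : ℤ) : Set where
    constructor mk≈
    field p∣i-j : + p ∣ i - j
  open _≈_

  _≉_ : ℤ → ℤ → Set
  i ≉ j = ¬ i ≈ j

  _≈?_ : ∀ i j → Dec (i ≈ j)
  i ≈? j = Dec.map′ mk≈ p∣i-j (+ p ∣? i - j)

  ≡⇒≈ : ∀ {i j} → i ≡ j → i ≈ j
  ≡⇒≈ {i} refl = mk≈ (divides 0ℤ (ℤ.+-inverseʳ i))

  ≈-refl : ∀ {i} → i ≈ i
  ≈-refl = ≡⇒≈ refl

  ≈-sym : ∀ {i j} → i ≈ j → j ≈ i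
  ≈-sym {i} {j} (mk≈ p∣i-j) = mk≈ (subst (+ p ∣_) (-[i-j]≡j-i i j) (∣m⇒∣-m p∣i-j))
    where
    -[i-j]≡j-i : ∀ i j → - (i - j) ≡ j - i
    -[i-j]≡j-i = solve-∀

  ≈-trans : ∀ {i j k} → i ≈ j → j ≈ k → i ≈ k
  ≈-trans {i} {j} {k} (mk≈ p∣i-j) (mk≈ p∣j-k) =
    mk≈ (subst (+ p ∣_) ([i-j]+[j-k]≡i-k i j k) (∣m∣n⇒∣m+n p∣i-j p∣j-k))
    where
    [i-j]+[j-k]≡i-k : ∀ i j k → (i - j) + (j - k) ≡ i - k
    [i-j]+[j-k]≡i-k = solve-∀

  ≈-setoid : Setoid 0ℓ 0ℓ
  ≈-setoid = record
    { Carrier       = ℤ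
    ; _≈_           = _≈_
    ; isEquivalence = record { refl = ≈-refl ; sym = ≈-sym ; trans = ≈-trans }
    }

  +-cong : ∀ {i j k l} → i ≈ j → k ≈ l → i + k ≈ j + l
  +-cong {i} {j} {k} {l} (mk≈ p∣i-j) (mk≈ p∣k-l) =
    mk≈ (subst (+ p ∣_) ([i-j]+[k-l]≡[i+k]-[j+l] i j k l) (∣m∣n⇒∣m+n p∣i-j p∣k-l))
    where
    [i-j]+[k-l]≡[i+k]-[j+l] : ∀ i j k l → (i - j) + (k - l) ≡ (i + k) - (j + l)
    [i-j]+[k-l]≡[i+k]-[j+l] = solve-∀

  -‿cong : ∀ {i j} → i ≈ j → - i ≈ - j
  -‿cong {i} {j} (mk≈ p∣i-j) = mk≈ (subst (+ p ∣_) (-[i-j]≡-i--j i j) (∣m⇒∣-m p∣i-j))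
    where
    -[i-j]≡-i--j : ∀ i j → - (i - j) ≡ - i - - j
    -[i-j]≡-i--j = solve-∀

  *-cong : ∀ {i j k l} → i ≈ j → k ≈ l → i * k ≈ j * l
  *-cong {i} {j} {k} {l} (mk≈ p∣i-j) (mk≈ p∣k-l) =
    mk≈ (subst (+ p ∣_) (k[i-j]+j[k-l]≡ik-jl i j k l) (∣m∣n⇒∣m+n (∣n⇒∣m*n k p∣i-j) (∣n⇒∣m*n j p∣k-l)))
    where
    k[i-j]+j[k-l]≡ik-jl : ∀ i j k l → k * (i - j) + j * (k - l) ≡ i * k - j * l
    k[i-j]+j[k-l]≡ik-jl = solve-∀

  +-multiple : ∀ i j → i + j * + p ≈ i
  +-multiple i j = mk≈ (divides j (i+jp-i≡jp i j (+ p)))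
    where
    i+jp-i≡jp : ∀ i j p → i + j * p - i ≡ j * p
    i+jp-i≡jp = solve-∀

  ≈0⇒∣ : ∀ {i} → i ≈ 0ℤ → + p ∣ i
  ≈0⇒∣ {i} (mk≈ p∣i-0) = subst (+ p ∣_) (ℤ.+-identityʳ i) p∣i-0

  ∣⇒≈0 : ∀ {i} → + p ∣ i → i ≈ 0ℤ
  ∣⇒≈0 {i} p∣i = mk≈ (subst (+ p ∣_) (sym (ℤ.+-identityʳ i)) p∣i)

  *-≈0 : ∀ i j → i * j ≈ 0ℤ → i ≈ 0ℤ ⊎ j ≈ 0ℤ
  *-≈0 i j ij≈0 = Sum.map (∣⇒≈0 ∘ ∣ᵤ⇒∣) (∣⇒≈0 ∘ ∣ᵤ⇒∣)
    (euclidsLemma ∣ i ∣ ∣ j ∣ prime (subst (p ℕ.∣_) (ℤ.abs-* i j) (∣⇒∣ᵤ (≈0⇒∣ ij≈0))))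

  *-cancelˡ-≈ : ∀ {i j} k → k ≉ 0ℤ → k * i ≈ k * j → i ≈ j
  *-cancelˡ-≈ {i} {j} k k≉0 (mk≈ p∣ki-kj) =
    Sum.[ ⊥-elim ∘ k≉0 , mk≈ ∘ ≈0⇒∣ ]′ (*-≈0 k (i - j) (mk≈ (subst (+ p ∣_) (ki-kj≡k[i-j]-0 k i j) p∣ki-kj)))
    where
    ki-kj≡k[i-j]-0 : ∀ k i j → k * i - k * j ≡ k * (i - j) - 0ℤ
    ki-kj≡k[i-j]-0 = solve-∀

  toℤ : Fin p → ℤ
  toℤ x = + toℕ x

  toℤ-mod : ∀ m → toℤ (m mod p) ≈ + m
  toℤ-mod m = ≈-sym (begin
    + m                                   ≡⟨ cong +_ (m≡m%n+[m/n]*n m p) ⟩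
    + (m % p ℕ.+ m / p ℕ.* p)             ≡⟨ ℤ.pos-+ (m % p) _ ⟩
    + (m % p) + + (m / p ℕ.* p)           ≡⟨ cong (_+_ (+ (m % p))) (ℤ.pos-* (m / p) p) ⟩
    + (m % p) + + (m / p) * + p           ≈⟨ +-multiple (+ (m % p)) (+ (m / p)) ⟩
    + (m % p)                             ≡⟨ cong +_ (toℕ-fromℕ< _) ⟨
    toℤ (m mod p)                         ∎)
    where open ≈-Reasoning ≈-setoid

  toℤ-addMod : ∀ x y → toℤ (addMod p x y) ≈ toℤ x + toℤ y
  toℤ-addMod x y = ≈-trans (toℤ-mod _) (≡⇒≈ (ℤ.pos-+ (toℕ x) (toℕ y)))

  toℤ-mulMod : ∀ x y → toℤ (mulMod p x y) ≈ toℤ x * toℤ y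
  toℤ-mulMod x y = ≈-trans (toℤ-mod _) (≡⇒≈ (ℤ.pos-* (toℕ x) (toℕ y)))

  subMod : Fin p → Fin p → Fin p
  subMod s x = (toℕ s ℕ.+ (p ℕ.∸ toℕ x)) mod p

  toℤ-subMod : ∀ s x → toℤ (subMod s x) ≈ toℤ s - toℤ x
  toℤ-subMod s x = begin
    toℤ (subMod s x)                     ≈⟨ toℤ-mod _ ⟩
    + (toℕ s ℕ.+ (p ℕ.∸ toℕ x))           ≡⟨ ℤ.pos-+ (toℕ s) _ ⟩
    toℤ s + + (p ℕ.∸ toℕ x)               ≡⟨ cong (_+_ (toℤ s)) (ℤ.⊖-≥ (ℕ.<⇒≤ (toℕ<n x))) ⟨
    toℤ s + (p ⊖ toℕ x)                   ≡⟨ cong (_+_ (toℤ s)) (ℤ.m-n≡m⊖n p (toℕ x)) ⟨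
    toℤ s + (+ p - toℤ x)                 ≡⟨ s+[p-x]≡s-x+1p (toℤ s) (toℤ x) (+ p) ⟩
    toℤ s - toℤ x + + 1 * + p             ≈⟨ +-multiple _ (+ 1) ⟩
    toℤ s - toℤ x                         ∎
    where
    open ≈-Reasoning ≈-setoid
    s+[p-x]≡s-x+1p : ∀ s x p → s + (p - x) ≡ s - x + + 1 * p
    s+[p-x]≡s-x+1p = solve-∀

  toℤ-injective : ∀ {x y} → toℤ x ≈ toℤ y → x ≡ y
  toℤ-injective {x} {y} (mk≈ p∣x-y) =
    toℕ-injective (ℤ.+-injective (ℤ.i-j≡0⇒i≡j _ _ (ℤ.∣i∣≡0⇒i≡0 ∣x-y∣≡0)))
    where
    ∣x-y∣<p : ∣ toℤ x - toℤ y ∣ ℕ.< p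
    ∣x-y∣<p = ℕ.≤-<-trans (ℕ.≤-reflexive (cong ∣_∣ (ℤ.m-n≡m⊖n (toℕ x) (toℕ y))))
                (ℕ.≤-<-trans (ℤ.∣m⊝n∣≤m⊔n (toℕ x) (toℕ y)) (ℕ.⊔-lub (toℕ<n x) (toℕ<n y)))
    ∣x-y∣≡0 : ∣ toℤ x - toℤ y ∣ ≡ 0
    ∣x-y∣≡0 = trans (sym (m<n⇒m%n≡m ∣x-y∣<p)) (ℕ.n∣m⇒m%n≡0 _ p (∣⇒∣ᵤ p∣x-y))

  toℤ-≈-unique : ∀ {x y i} → toℤ x ≈ i → toℤ y ≈ i → x ≡ y
  toℤ-≈-unique x≈i y≈i = toℤ-injective (≈-trans x≈i (≈-sym y≈i))

  addMod-subMod : ∀ x s → addMod p x (subMod s x) ≡ s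
  addMod-subMod x s = toℤ-injective (begin
    toℤ (addMod p x (subMod s x))   ≈⟨ toℤ-addMod x _ ⟩
    toℤ x + toℤ (subMod s x)        ≈⟨ +-cong (≈-refl {toℤ x}) (toℤ-subMod s x) ⟩
    toℤ x + (toℤ s - toℤ x)         ≡⟨ x+[s-x]≡s (toℤ x) (toℤ s) ⟩
    toℤ s                           ∎)
    where
    open ≈-Reasoning ≈-setoid
    x+[s-x]≡s : ∀ x s → x + (s - x) ≡ s
    x+[s-x]≡s = solve-∀

  subMod-addMod : ∀ x k → subMod (addMod p x k) x ≡ k
  subMod-addMod x k = toℤ-injective (begin
    toℤ (subMod (addMod p x k) x)   ≈⟨ toℤ-subMod _ x ⟩
    toℤ (addMod p x k) - toℤ x      ≈⟨ +-cong (toℤ-addMod x k) (≈-refl { - toℤ x}) ⟩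
    toℤ x + toℤ k - toℤ x           ≡⟨ x+k-x≡k (toℤ x) (toℤ k) ⟩
    toℤ k                           ∎)
    where
    open ≈-Reasoning ≈-setoid
    x+k-x≡k : ∀ x k → x + k - x ≡ k
    x+k-x≡k = solve-∀

  translation : Fin p → Permutation′ p
  translation x = permutation (addMod p x) (λ s → subMod s x) (addMod-subMod x) (subMod-addMod x)

  splitProduct : Fin p → Fin p → Fin p
  splitProduct s x = mulMod p x (subMod s x)

  toℤ-splitProduct : ∀ s x → toℤ (splitProduct s x) ≈ toℤ x * (toℤ s - toℤ x)
  toℤ-splitProduct s x = ≈-trans (toℤ-mulMod x _) (*-cong (≈-refl {toℤ x}) (toℤ-subMod s x))

  -- splitProduct s' (x + k) − splitProduct s x ≡ slope s s' k · x + k (s' − k)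
  slope : Fin p → Fin p → Fin p → ℤ
  slope s s' k = toℤ s' - toℤ s - + 2 * toℤ k

  shift-equation : ∀ s s' k x → splitProduct s' (addMod p x k) ≡ splitProduct s x →
                   slope s s' k * toℤ x ≈ toℤ k * (toℤ k - toℤ s')
  shift-equation s s' k x eq = begin
    slope s s' k * X                                 ≡⟨ expand S S' K X ⟩
    (X + K) * (S' - (X + K)) - X * (S - X) + K * (K - S')
      ≈⟨ +-cong (+-cong shifted (≈-refl { - (X * (S - X))})) (≈-refl {K * (K - S')}) ⟩
    X * (S - X) - X * (S - X) + K * (K - S')          ≡⟨ cancel (X * (S - X)) (K * (K - S')) ⟩
    K * (K - S')                                     ∎
    where
    open ≈-Reasoning ≈-setoid
    S S' K X : ℤ
    S = toℤ s ; S' = toℤ s' ; K = toℤ k ; X = toℤ x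
    x' : Fin p
    x' = addMod p x k
    shifted : (X + K) * (S' - (X + K)) ≈ X * (S - X)
    shifted = begin
      (X + K) * (S' - (X + K))    ≈⟨ *-cong (toℤ-addMod x k) (+-cong (≈-refl {S'}) (-‿cong (toℤ-addMod x k))) ⟨
      toℤ x' * (S' - toℤ x')      ≈⟨ toℤ-splitProduct s' x' ⟨
      toℤ (splitProduct s' x')    ≡⟨ cong toℤ eq ⟩
      toℤ (splitProduct s x)      ≈⟨ toℤ-splitProduct s x ⟩
      X * (S - X)                 ∎
    expand : ∀ S S' K X → (S' - S - + 2 * K) * X ≡ (X + K) * (S' - (X + K)) - X * (S - X) + K * (K - S')
    expand = solve-∀
    cancel : ∀ a b → a - a + b ≡ b
    cancel = solve-∀

  shift-solution-unique : ∀ s s' k {x₁ x₂} → slope s s' k ≉ 0ℤ →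
                          splitProduct s' (addMod p x₁ k) ≡ splitProduct s x₁ →
                          splitProduct s' (addMod p x₂ k) ≡ splitProduct s x₂ → x₁ ≡ x₂
  shift-solution-unique s s' k {x₁} {x₂} c≉0 eq₁ eq₂ =
    toℤ-injective (*-cancelˡ-≈ _ c≉0
      (≈-trans (shift-equation s s' k x₁ eq₁) (≈-sym (shift-equation s s' k x₂ eq₂))))

  shift-solution-degenerate : ∀ s s' k x → slope s s' k ≈ 0ℤ →
                              splitProduct s' (addMod p x k) ≡ splitProduct s x →
                              toℤ s' ≈ toℤ s ⊎ toℤ s' ≈ - toℤ s
  shift-solution-degenerate s s' k x c≈0 eq = Sum.map K≈0⇒S'≈S K-S'≈0⇒S'≈-S (*-≈0 K (K - S') K[K-S']≈0)
    where
    open ≈-Reasoning ≈-setoid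
    S S' K c : ℤ
    S = toℤ s ; S' = toℤ s' ; K = toℤ k ; c = slope s s' k
    K[K-S']≈0 : K * (K - S') ≈ 0ℤ
    K[K-S']≈0 = begin
      K * (K - S')    ≈⟨ shift-equation s s' k x eq ⟨
      c * toℤ x       ≈⟨ *-cong c≈0 (≈-refl {toℤ x}) ⟩
      0ℤ              ∎
    K≈0⇒S'≈S : K ≈ 0ℤ → S' ≈ S
    K≈0⇒S'≈S K≈0 = begin
      S'                     ≡⟨ s'≡s+c+2k S S' K ⟩
      S + c + + 2 * K        ≈⟨ +-cong (+-cong (≈-refl {S}) c≈0) (*-cong (≈-refl {+ 2}) K≈0) ⟩
      S + 0ℤ + + 2 * 0ℤ      ≡⟨ ℤ.+-identityʳ (S + 0ℤ) ⟩
      S + 0ℤ                 ≡⟨ ℤ.+-identityʳ S ⟩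
      S                      ∎
      where
      s'≡s+c+2k : ∀ s s' k → s' ≡ s + (s' - s - + 2 * k) + + 2 * k
      s'≡s+c+2k = solve-∀
    K-S'≈0⇒S'≈-S : K - S' ≈ 0ℤ → S' ≈ - S
    K-S'≈0⇒S'≈-S K-S'≈0 = begin
      S'                             ≡⟨ s'≡-s-c-2[k-s'] S S' K ⟩
      - S - c - + 2 * (K - S')
        ≈⟨ +-cong (+-cong (≈-refl { - S}) (-‿cong c≈0)) (-‿cong (*-cong (≈-refl {+ 2}) K-S'≈0)) ⟩
      - S - 0ℤ - + 2 * 0ℤ             ≡⟨ ℤ.+-identityʳ (- S - 0ℤ) ⟩
      - S - 0ℤ                       ≡⟨ ℤ.+-identityʳ (- S) ⟩
      - S                            ∎
      where
      s'≡-s-c-2[k-s'] : ∀ s s' k → s' ≡ - s - (s' - s - + 2 * k) - + 2 * (k - s')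
      s'≡-s-c-2[k-s'] = solve-∀

  slope-root-unique : 2 ℕ.< p → ∀ s s' {k₁ k₂} → slope s s' k₁ ≈ 0ℤ → slope s s' k₂ ≈ 0ℤ → k₁ ≡ k₂
  slope-root-unique 2<p s s' {k₁} {k₂} c₁≈0 c₂≈0 = toℤ-injective (*-cancelˡ-≈ (+ 2) 2≉0 (begin
    + 2 * K₁                 ≡⟨ 2k≡s'-s-c S S' K₁ ⟩
    S' - S - slope s s' k₁   ≈⟨ +-cong (≈-refl {S' - S}) (-‿cong (≈-trans c₁≈0 (≈-sym c₂≈0))) ⟩
    S' - S - slope s s' k₂   ≡⟨ 2k≡s'-s-c S S' K₂ ⟨
    + 2 * K₂                 ∎))
    where
    open ≈-Reasoning ≈-setoid
    S S' K₁ K₂ : ℤ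
    S = toℤ s ; S' = toℤ s' ; K₁ = toℤ k₁ ; K₂ = toℤ k₂
    2k≡s'-s-c : ∀ s s' k → + 2 * k ≡ s' - s - (s' - s - + 2 * k)
    2k≡s'-s-c = solve-∀
    2≉0 : + 2 ≉ 0ℤ
    2≉0 2≈0 = ℕ.<⇒≱ 2<p (ℕ.∣⇒≤ (∣⇒∣ᵤ (≈0⇒∣ 2≈0)))

open import Data.Fin.Subset using (Subset; _∈_; _∉_; ∁; ∣_∣; inside; outside)
open import Data.Fin.Subset.Properties using (_∈?_; ∣p∣≤n; ∣∁p∣≡n∸∣p∣; x∉∁p⇒x∈p)
open import Data.Nat.Base using (zero; suc; _+_; _*_; _≤_; _<_; _≥_; z≤n; s≤s)
open import Data.Nat.Properties hiding (_≟_)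
open import Data.Nat.Tactic.RingSolver using (solve-∀)
open import Algebra.Properties.CommutativeMonoid.Sum +-0-commutativeMonoid
  using (∑-comm; ∑-distrib-+; ∑-permute)
open import Algebra.Properties.Semiring.Sum +-*-semiring
  using (sum-syntax; sum-cong-≗; sum-replicate-zero; *-distribˡ-sum; *-distribʳ-sum)

⟦_⟧ : {P : Set} → Dec P → ℕ
⟦ P? ⟧ = if does P? then 1 else 0

module _ {P : Set} where

  ⟦⟧≤1 : (P? : Dec P) → ⟦ P? ⟧ ≤ 1
  ⟦⟧≤1 (yes _) = ≤-refl
  ⟦⟧≤1 (no _)  = z≤n

  ⟦⟧≡0 : (P? : Dec P) → ¬ P → ⟦ P? ⟧ ≡ 0
  ⟦⟧≡0 (yes p) ¬p = ⊥-elim (¬p p)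
  ⟦⟧≡0 (no _)  _  = refl

  ⟦⟧-idem : (P? : Dec P) → ⟦ P? ⟧ * ⟦ P? ⟧ ≡ ⟦ P? ⟧
  ⟦⟧-idem (yes _) = refl
  ⟦⟧-idem (no _)  = refl

  ⟦⟧*≤ : (P? : Dec P) (n : ℕ) → ⟦ P? ⟧ * n ≤ n
  ⟦⟧*≤ (yes _) n = ≤-reflexive (+-identityʳ n)
  ⟦⟧*≤ (no _)  n = z≤n

  ⟦⟧*-absorb : (P? : Dec P) {n : ℕ} → (¬ P → n ≡ 0) → ⟦ P? ⟧ * n ≡ n
  ⟦⟧*-absorb (yes _) _   = +-identityʳ _
  ⟦⟧*-absorb (no ¬p) n≡0 = sym (n≡0 ¬p)

  ⟦⟧*≡0 : (P? : Dec P) {n : ℕ} → (P → n ≡ 0) → ⟦ P? ⟧ * n ≡ 0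
  ⟦⟧*≡0 (yes p) n≡0 = trans (+-identityʳ _) (n≡0 p)
  ⟦⟧*≡0 (no _)  _   = refl

∑-mono-≤ : ∀ {n} {f g : Fin n → ℕ} → (∀ i → f i ≤ g i) → ∑[ i < n ] f i ≤ ∑[ i < n ] g i
∑-mono-≤ {zero}  _   = z≤n
∑-mono-≤ {suc n} f≤g = +-mono-≤ (f≤g zero) (∑-mono-≤ (f≤g ∘ suc))

∑-const : ∀ n c → ∑[ i < n ] c ≡ n * c
∑-const zero    c = refl
∑-const (suc n) c = cong (c +_) (∑-const n c)

∑-*-∑ : ∀ {m n} (f : Fin m → ℕ) (g : Fin n → ℕ) →
        ∑[ i < m ] f i * ∑[ j < n ] g j ≡ ∑[ i < m ] ∑[ j < n ] (f i * g j)
∑-*-∑ f g = trans (*-distribʳ-sum _ f) (sum-cong-≗ (λ i → *-distribˡ-sum (f i) g))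

∑-⟦⟧≤n : ∀ {n} {P : Fin n → Set} (P? : ∀ i → Dec (P i)) → ∑[ i < n ] ⟦ P? i ⟧ ≤ n
∑-⟦⟧≤n {n} P? = ≤-trans (∑-mono-≤ (⟦⟧≤1 ∘ P?)) (≤-reflexive (trans (∑-const n 1) (*-identityʳ n)))

∑-⟦⟧≤1 : ∀ {n} {P : Fin n → Set} (P? : ∀ i → Dec (P i)) →
         (∀ {i j} → P i → P j → i ≡ j) → ∑[ i < n ] ⟦ P? i ⟧ ≤ 1
∑-⟦⟧≤1 {zero}  P? unique = z≤n
∑-⟦⟧≤1 {suc n} P? unique with P? zero
... | yes P0 = ≤-reflexive (cong suc (trans
      (sum-cong-≗ (λ i → ⟦⟧≡0 (P? (suc i)) (λ Pi → Fin.0≢1+n (unique P0 Pi))))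
      (sum-replicate-zero n)))
... | no _   = ∑-⟦⟧≤1 (P? ∘ suc) (λ Pi Pj → Fin.suc-injective (unique Pi Pj))

∑-δ : ∀ {n} (c : Fin n) (f : Fin n → ℕ) → ∑[ t < n ] (⟦ c ≟ t ⟧ * f t) ≡ f c
∑-δ {suc n} zero    f = trans (cong₂ _+_ (+-identityʳ (f zero)) (sum-replicate-zero n)) (+-identityʳ (f zero))
∑-δ {suc n} (suc c) f = ∑-δ c (f ∘ suc)

χ : ∀ {n} → Subset n → Fin n → ℕ
χ S i = ⟦ i ∈? S ⟧

∣S∣≡∑χ : ∀ {n} (S : Subset n) → ∣ S ∣ ≡ ∑[ i < n ] χ S i
∣S∣≡∑χ []            = refl
∣S∣≡∑χ (inside ∷ S)  = cong suc (∣S∣≡∑χ S)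
∣S∣≡∑χ (outside ∷ S) = ∣S∣≡∑χ S

fibre : ∀ {m n} → (Fin m → Fin n) → Fin n → ℕ
fibre {m} f t = ∑[ x < m ] ⟦ f x ≟ t ⟧

∑-fibre : ∀ {m n} (f : Fin m → Fin n) → ∑[ t < n ] fibre f t ≡ m
∑-fibre {m} {n} f = begin
  ∑[ t < n ] ∑[ x < m ] ⟦ f x ≟ t ⟧          ≡⟨ ∑-comm (λ t x → ⟦ f x ≟ t ⟧) ⟩
  ∑[ x < m ] ∑[ t < n ] ⟦ f x ≟ t ⟧          ≡⟨ sum-cong-≗ {m} (λ x → sum-cong-≗ {n} (λ t → *-identityʳ _)) ⟨
  ∑[ x < m ] ∑[ t < n ] (⟦ f x ≟ t ⟧ * 1)    ≡⟨ sum-cong-≗ {m} (λ x → ∑-δ (f x) (λ _ → 1)) ⟩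
  ∑[ x < m ] 1                               ≡⟨ ∑-const m 1 ⟩
  m * 1                                      ≡⟨ *-identityʳ m ⟩
  m                                          ∎
  where open ≡-Reasoning

∑-fibre-*-fibre : ∀ {m m' n} (f : Fin m → Fin n) (g : Fin m' → Fin n) →
                  ∑[ t < n ] (fibre f t * fibre g t) ≡ ∑[ x < m ] fibre g (f x)
∑-fibre-*-fibre {m} {m'} {n} f g = begin
  ∑[ t < n ] (fibre f t * fibre g t)
    ≡⟨ sum-cong-≗ {n} (λ t → *-distribʳ-sum (fibre g t) (λ x → ⟦ f x ≟ t ⟧)) ⟩
  ∑[ t < n ] ∑[ x < m ] (⟦ f x ≟ t ⟧ * fibre g t)
    ≡⟨ ∑-comm (λ t x → ⟦ f x ≟ t ⟧ * fibre g t) ⟩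
  ∑[ x < m ] ∑[ t < n ] (⟦ f x ≟ t ⟧ * fibre g t)
    ≡⟨ sum-cong-≗ (λ x → ∑-δ (f x) (fibre g)) ⟩
  ∑[ x < m ] fibre g (f x)
    ∎
  where open ≡-Reasoning

2mn≤m²+n² : ∀ m n → 2 * (m * n) ≤ m * m + n * n
2mn≤m²+n² zero    n       = z≤n
2mn≤m²+n² (suc m) zero    = ≤-trans (≤-reflexive (cong (2 *_) (*-zeroʳ (suc m)))) z≤n
2mn≤m²+n² (suc m) (suc n) =
  subst₂ _≤_ (lhs m n) (rhs m n) (+-monoˡ-≤ (2 * m + 2 * n + 2) (2mn≤m²+n² m n))
  where
  lhs : ∀ m n → 2 * (m * n) + (2 * m + 2 * n + 2) ≡ 2 * (suc m * suc n)
  lhs = solve-∀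
  rhs : ∀ m n → m * m + n * n + (2 * m + 2 * n + 2) ≡ suc m * suc m + suc n * suc n
  rhs = solve-∀

cauchy-schwarz : ∀ {n} (f g : Fin n → ℕ) →
  ∑[ i < n ] (f i * g i) * ∑[ i < n ] (f i * g i) ≤ ∑[ i < n ] (f i * f i) * ∑[ i < n ] (g i * g i)
cauchy-schwarz {n} f g = *-cancelˡ-≤ 2 (begin
  2 * (∑[ i < n ] (f i * g i) * ∑[ j < n ] (f j * g j))
    ≡⟨ cong (2 *_) (∑-*-∑ (λ i → f i * g i) (λ j → f j * g j)) ⟩
  2 * ∑[ i < n ] ∑[ j < n ] (f i * g i * (f j * g j))
    ≡⟨ cong (2 *_) (sum-cong-≗ {n} (λ i → sum-cong-≗ {n} (λ j → swap (f i) (g i) (f j) (g j)))) ⟩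
  2 * ∑[ i < n ] ∑[ j < n ] (u i j * u j i)
    ≡⟨ *-distribˡ-sum 2 (λ i → ∑[ j < n ] (u i j * u j i)) ⟩
  ∑[ i < n ] (2 * ∑[ j < n ] (u i j * u j i))
    ≡⟨ sum-cong-≗ {n} (λ i → *-distribˡ-sum 2 (λ j → u i j * u j i)) ⟩
  ∑[ i < n ] ∑[ j < n ] (2 * (u i j * u j i))
    ≤⟨ ∑-mono-≤ (λ i → ∑-mono-≤ (λ j → 2mn≤m²+n² (u i j) (u j i))) ⟩
  ∑[ i < n ] ∑[ j < n ] (u i j * u i j + u j i * u j i)
    ≡⟨ sum-cong-≗ {n} (λ i → ∑-distrib-+ (λ j → u i j * u i j) (λ j → u j i * u j i)) ⟩
  ∑[ i < n ] (∑[ j < n ] (u i j * u i j) + ∑[ j < n ] (u j i * u j i))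
    ≡⟨ ∑-distrib-+ (λ i → ∑[ j < n ] (u i j * u i j)) (λ i → ∑[ j < n ] (u j i * u j i)) ⟩
  U + ∑[ i < n ] ∑[ j < n ] (u j i * u j i)
    ≡⟨ cong (U +_) (∑-comm (λ i j → u j i * u j i)) ⟩
  U + U
    ≡⟨ cong₂ _+_ U≡FG (trans U≡FG (sym (+-identityʳ _))) ⟩
  2 * (∑[ i < n ] (f i * f i) * ∑[ j < n ] (g j * g j))
    ∎)
  where
  open ≤-Reasoning
  swap : ∀ a b c d → a * b * (c * d) ≡ a * d * (c * b)
  swap = solve-∀
  square-distrib : ∀ a b → a * b * (a * b) ≡ a * a * (b * b)
  square-distrib = solve-∀
  u : Fin n → Fin n → ℕ
  u i j = f i * g j
  U : ℕ
  U = ∑[ i < n ] ∑[ j < n ] (u i j * u i j)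
  U≡FG : U ≡ ∑[ i < n ] (f i * f i) * ∑[ j < n ] (g j * g j)
  U≡FG = trans (sum-cong-≗ {n} (λ i → sum-cong-≗ {n} (λ j → square-distrib (f i) (g j))))
               (sym (∑-*-∑ (λ i → f i * f i) (λ j → g j * g j)))

∑²≤∣S∣*∑-square : ∀ {n} (S : Subset n) (f : Fin n → ℕ) → (∀ t → t ∉ S → f t ≡ 0) →
                  ∑[ t < n ] f t * ∑[ t < n ] f t ≤ ∣ S ∣ * ∑[ t < n ] (f t * f t)
∑²≤∣S∣*∑-square {n} S f vanishes = begin
  ∑[ t < n ] f t * ∑[ t < n ] f t
    ≡⟨ cong₂ _*_ ∑f≡∑χf ∑f≡∑χf ⟩
  ∑[ t < n ] (χ S t * f t) * ∑[ t < n ] (χ S t * f t)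
    ≤⟨ cauchy-schwarz (χ S) f ⟩
  ∑[ t < n ] (χ S t * χ S t) * ∑[ t < n ] (f t * f t)
    ≡⟨ cong (_* ∑[ t < n ] (f t * f t)) (trans (sum-cong-≗ {n} (λ t → ⟦⟧-idem (t ∈? S))) (sym (∣S∣≡∑χ S))) ⟩
  ∣ S ∣ * ∑[ t < n ] (f t * f t)
    ∎
  where
  open ≤-Reasoning
  ∑f≡∑χf : ∑[ t < n ] f t ≡ ∑[ t < n ] (χ S t * f t)
  ∑f≡∑χf = sum-cong-≗ {n} (λ t → sym (⟦⟧*-absorb (t ∈? S) (vanishes t)))

∑-square-of-∑ : ∀ {m n} (a : Fin m → ℕ) (F : Fin m → Fin n → ℕ) →
  ∑[ t < n ] (∑[ s < m ] (a s * F s t) * ∑[ s < m ] (a s * F s t)) ≡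
  ∑[ s < m ] (a s * ∑[ s' < m ] (a s' * ∑[ t < n ] (F s t * F s' t)))
∑-square-of-∑ {m} {n} a F = begin
  ∑[ t < n ] (∑[ s < m ] (a s * F s t) * ∑[ s < m ] (a s * F s t))
    ≡⟨ sum-cong-≗ {n} (λ t → ∑-*-∑ (λ s → a s * F s t) (λ s' → a s' * F s' t)) ⟩
  ∑[ t < n ] ∑[ s < m ] ∑[ s' < m ] G t s s'
    ≡⟨ ∑-comm (λ t s → ∑[ s' < m ] G t s s') ⟩
  ∑[ s < m ] ∑[ t < n ] ∑[ s' < m ] G t s s'
    ≡⟨ sum-cong-≗ {m} (λ s → ∑-comm (λ t s' → G t s s')) ⟩
  ∑[ s < m ] ∑[ s' < m ] ∑[ t < n ] G t s s'
    ≡⟨ sum-cong-≗ {m} (λ s → sum-cong-≗ {m} (λ s' → sum-cong-≗ {n} (λ t →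
         interchange (a s) (F s t) (a s') (F s' t)))) ⟩
  ∑[ s < m ] ∑[ s' < m ] ∑[ t < n ] (a s * (a s' * (F s t * F s' t)))
    ≡⟨ sum-cong-≗ {m} (λ s → sum-cong-≗ {m} (λ s' → sym (pull (a s) (a s') (λ t → F s t * F s' t)))) ⟩
  ∑[ s < m ] ∑[ s' < m ] (a s * (a s' * ∑[ t < n ] (F s t * F s' t)))
    ≡⟨ sum-cong-≗ {m} (λ s → *-distribˡ-sum (a s) (λ s' → a s' * ∑[ t < n ] (F s t * F s' t))) ⟨
  ∑[ s < m ] (a s * ∑[ s' < m ] (a s' * ∑[ t < n ] (F s t * F s' t)))
    ∎
  where
  open ≡-Reasoning
  G : Fin n → Fin m → Fin m → ℕ
  G t s s' = a s * F s t * (a s' * F s' t)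
  interchange : ∀ a f b g → a * f * (b * g) ≡ a * (b * (f * g))
  interchange = solve-∀
  pull : ∀ a b (h : Fin n → ℕ) → a * (b * ∑[ t < n ] h t) ≡ ∑[ t < n ] (a * (b * h t))
  pull a b h = trans (cong (a *_) (*-distribˡ-sum b h)) (*-distribˡ-sum a (λ t → b * h t))

[a*n]²≤w*a*[a+2]*n⇒a*b≤2*n : ∀ {n} a b w .{{_ : NonZero n}} → w + b ≡ n →
                               a * n * (a * n) ≤ w * (a * ((a + 2) * n)) → a * b ≤ 2 * n
[a*n]²≤w*a*[a+2]*n⇒a*b≤2*n zero        _ _ _     _   = z≤n
[a*n]²≤w*a*[a+2]*n⇒a*b≤2*n {n} a@(suc _) b w w+b≡n sq≤ =
  ≤-trans a*b≤2*w (*-monoʳ-≤ 2 (≤-trans (m≤m+n w b) (≤-reflexive w+b≡n)))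
  where
  open ≤-Reasoning
  instance
    a*n≢0 : NonZero (a * n)
    a*n≢0 = m*n≢0 a n
  regroup : ∀ a n w → w * (a * ((a + 2) * n)) ≡ a * n * (w * (a + 2))
  regroup = solve-∀
  expand : ∀ a w → w * (a + 2) ≡ a * w + 2 * w
  expand = solve-∀
  a*n≤w*[a+2] : a * n ≤ w * (a + 2)
  a*n≤w*[a+2] = *-cancelˡ-≤ (a * n) (≤-trans sq≤ (≤-reflexive (regroup a n w)))
  a*b≤2*w : a * b ≤ 2 * w
  a*b≤2*w = +-cancelˡ-≤ (a * w) _ _ (begin
    a * w + a * b   ≡⟨ *-distribˡ-+ a w b ⟨
    a * (w + b)     ≡⟨ cong (a *_) w+b≡n ⟩
    a * n           ≤⟨ a*n≤w*[a+2] ⟩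
    w * (a + 2)     ≡⟨ expand a w ⟩
    a * w + 2 * w   ∎)

module Representations (p : ℕ) (prime : Prime p) (2<p : 2 < p) where
  open ModularArithmetic p prime
    using (p≢0; toℤ; _≈_; _≈?_; slope; subMod; splitProduct; translation; addMod-subMod; toℤ-≈-unique;
           shift-solution-unique; shift-solution-degenerate; slope-root-unique)
  open import Data.Integer.Base using (-_; 0ℤ)

  ±-matches : Fin p → Fin p → ℕ
  ±-matches s s' = ⟦ toℤ s' ≈? toℤ s ⟧ + ⟦ toℤ s' ≈? - toℤ s ⟧

  ∑-±-matches≤2 : ∀ s → ∑[ s' < p ] ±-matches s s' ≤ 2
  ∑-±-matches≤2 s = begin
    ∑[ s' < p ] ±-matches s s'
      ≡⟨ ∑-distrib-+ (λ s' → ⟦ toℤ s' ≈? toℤ s ⟧) (λ s' → ⟦ toℤ s' ≈? - toℤ s ⟧) ⟩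
    ∑[ s' < p ] ⟦ toℤ s' ≈? toℤ s ⟧ + ∑[ s' < p ] ⟦ toℤ s' ≈? - toℤ s ⟧
      ≤⟨ +-mono-≤ (∑-⟦⟧≤1 (λ s' → toℤ s' ≈? toℤ s) toℤ-≈-unique)
                  (∑-⟦⟧≤1 (λ s' → toℤ s' ≈? - toℤ s) toℤ-≈-unique) ⟩
    2 ∎
    where open ≤-Reasoning

  shiftSolutions : Fin p → Fin p → Fin p → ℕ
  shiftSolutions s s' k = ∑[ x < p ] ⟦ splitProduct s' (addMod p x k) ≟ splitProduct s x ⟧

  shiftSolutions≤ : ∀ s s' k → shiftSolutions s s' k ≤ 1 + ⟦ slope s s' k ≈? 0ℤ ⟧ * (p * ±-matches s s')
  shiftSolutions≤ s s' k = by-slope (slope s s' k ≈? 0ℤ)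
    where
    shifted? : ∀ x → Dec (splitProduct s' (addMod p x k) ≡ splitProduct s x)
    shifted? x = splitProduct s' (addMod p x k) ≟ splitProduct s x
    by-slope : (c≈?0 : Dec (slope s s' k ≈ 0ℤ)) → shiftSolutions s s' k ≤ 1 + ⟦ c≈?0 ⟧ * (p * ±-matches s s')
    by-slope (no c≉0)  = ∑-⟦⟧≤1 shifted? (shift-solution-unique s s' k c≉0)
    by-slope (yes c≈0) = ≤-trans (by-sign (toℤ s' ≈? toℤ s) (toℤ s' ≈? - toℤ s))
                              (≤-trans (≤-reflexive (sym (*-identityˡ _))) (m≤n+m _ 1))
      where
      by-sign : (s'≈?s : Dec (toℤ s' ≈ toℤ s)) (s'≈?-s : Dec (toℤ s' ≈ - toℤ s)) →
                   shiftSolutions s s' k ≤ p * (⟦ s'≈?s ⟧ + ⟦ s'≈?-s ⟧)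
      by-sign (yes _)   _          = ≤-trans (∑-⟦⟧≤n shifted?) (m≤m*n p _)
      by-sign (no _)    (yes _)    = ≤-trans (∑-⟦⟧≤n shifted?) (m≤m*n p 1)
      by-sign (no s'≉s) (no s'≉-s) = ≤-trans (≤-reflexive (trans
        (sum-cong-≗ {p} (λ x → ⟦⟧≡0 (shifted? x) (λ eq →
          Sum.[ s'≉s , s'≉-s ]′ (shift-solution-degenerate s s' k x c≈0 eq))))
        (sum-replicate-zero p))) z≤n

  collisions : Fin p → Fin p → ℕ
  collisions s s' = ∑[ x < p ] fibre (splitProduct s') (splitProduct s x)

  collisions≤ : ∀ s s' → collisions s s' ≤ p + p * ±-matches s s'
  collisions≤ s s' = begin
    ∑[ x < p ] ∑[ x' < p ] ⟦ splitProduct s' x' ≟ splitProduct s x ⟧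
      ≡⟨ sum-cong-≗ {p} (λ x → ∑-permute (λ x' → ⟦ splitProduct s' x' ≟ splitProduct s x ⟧) (translation x)) ⟩
    ∑[ x < p ] ∑[ k < p ] ⟦ splitProduct s' (addMod p x k) ≟ splitProduct s x ⟧
      ≡⟨ ∑-comm (λ x k → ⟦ splitProduct s' (addMod p x k) ≟ splitProduct s x ⟧) ⟩
    ∑[ k < p ] shiftSolutions s s' k
      ≤⟨ ∑-mono-≤ (shiftSolutions≤ s s') ⟩
    ∑[ k < p ] (1 + critical k * m)
      ≡⟨ ∑-distrib-+ (λ _ → 1) (λ k → critical k * m) ⟩
    ∑[ k < p ] 1 + ∑[ k < p ] (critical k * m)
      ≡⟨ cong₂ _+_ (trans (∑-const p 1) (*-identityʳ p)) (sym (*-distribʳ-sum m critical)) ⟩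
    p + ∑[ k < p ] critical k * m
      ≤⟨ +-monoʳ-≤ p (*-monoˡ-≤ m (∑-⟦⟧≤1 (λ k → slope s s' k ≈? 0ℤ) (slope-root-unique 2<p s s'))) ⟩
    p + 1 * m
      ≡⟨ cong (p +_) (*-identityˡ m) ⟩
    p + m
      ∎
    where
    open ≤-Reasoning
    m : ℕ
    m = p * ±-matches s s'
    critical : Fin p → ℕ
    critical k = ⟦ slope s s' k ≈? 0ℤ ⟧

  -- The pairs (x, y) with x + y ∈ A and x y = t, indexed by s = x + y and x.
  representations : Subset p → Fin p → ℕ
  representations A t = ∑[ s < p ] (χ A s * fibre (splitProduct s) t)

  ∑-representations : ∀ A → ∑[ t < p ] representations A t ≡ ∣ A ∣ * p
  ∑-representations A = begin
    ∑[ t < p ] ∑[ s < p ] (χ A s * fibre (splitProduct s) t)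
      ≡⟨ ∑-comm (λ t s → χ A s * fibre (splitProduct s) t) ⟩
    ∑[ s < p ] ∑[ t < p ] (χ A s * fibre (splitProduct s) t)
      ≡⟨ sum-cong-≗ {p} (λ s → *-distribˡ-sum (χ A s) (fibre (splitProduct s))) ⟨
    ∑[ s < p ] (χ A s * ∑[ t < p ] fibre (splitProduct s) t)
      ≡⟨ sum-cong-≗ {p} (λ s → cong (χ A s *_) (∑-fibre (splitProduct s))) ⟩
    ∑[ s < p ] (χ A s * p)
      ≡⟨ *-distribʳ-sum p (χ A) ⟨
    ∑[ s < p ] χ A s * p
      ≡⟨ cong (_* p) (∣S∣≡∑χ A) ⟨
    ∣ A ∣ * p
      ∎
    where open ≡-Reasoning

  ∑-χ*collisions≤ : ∀ A s → ∑[ s' < p ] (χ A s' * collisions s s') ≤ (∣ A ∣ + 2) * p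
  ∑-χ*collisions≤ A s = begin
    ∑[ s' < p ] (χ A s' * collisions s s')
      ≤⟨ ∑-mono-≤ (λ s' → *-monoʳ-≤ (χ A s') (collisions≤ s s')) ⟩
    ∑[ s' < p ] (χ A s' * (p + p * ±-matches s s'))
      ≤⟨ ∑-mono-≤ (λ s' → ≤-trans (≤-reflexive (*-distribˡ-+ (χ A s') p _))
                                  (+-monoʳ-≤ (χ A s' * p) (⟦⟧*≤ (s' ∈? A) _))) ⟩
    ∑[ s' < p ] (χ A s' * p + p * ±-matches s s')
      ≡⟨ ∑-distrib-+ (λ s' → χ A s' * p) (λ s' → p * ±-matches s s') ⟩
    ∑[ s' < p ] (χ A s' * p) + ∑[ s' < p ] (p * ±-matches s s')
      ≡⟨ cong₂ _+_ (trans (cong (_* p) (∣S∣≡∑χ A)) (*-distribʳ-sum p (χ A)))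
                   (*-distribˡ-sum p (±-matches s)) ⟨
    ∣ A ∣ * p + p * ∑[ s' < p ] ±-matches s s'
      ≤⟨ +-monoʳ-≤ (∣ A ∣ * p) (*-monoʳ-≤ p (∑-±-matches≤2 s)) ⟩
    ∣ A ∣ * p + p * 2
      ≡⟨ cong (∣ A ∣ * p +_) (*-comm p 2) ⟩
    ∣ A ∣ * p + 2 * p
      ≡⟨ *-distribʳ-+ p ∣ A ∣ 2 ⟨
    (∣ A ∣ + 2) * p
      ∎
    where open ≤-Reasoning

  ∑-representations² : ∀ A →
    ∑[ t < p ] (representations A t * representations A t) ≤ ∣ A ∣ * ((∣ A ∣ + 2) * p)
  ∑-representations² A = begin
    ∑[ t < p ] (representations A t * representations A t)
      ≡⟨ ∑-square-of-∑ (χ A) (λ s → fibre (splitProduct s)) ⟩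
    ∑[ s < p ] (χ A s * ∑[ s' < p ] (χ A s' * ∑[ t < p ] (fibre (splitProduct s) t * fibre (splitProduct s') t)))
      ≡⟨ sum-cong-≗ {p} (λ s → cong (χ A s *_) (sum-cong-≗ {p} (λ s' →
           cong (χ A s' *_) (∑-fibre-*-fibre (splitProduct s) (splitProduct s'))))) ⟩
    ∑[ s < p ] (χ A s * ∑[ s' < p ] (χ A s' * collisions s s'))
      ≤⟨ ∑-mono-≤ (λ s → *-monoʳ-≤ (χ A s) (∑-χ*collisions≤ A s)) ⟩
    ∑[ s < p ] (χ A s * ((∣ A ∣ + 2) * p))
      ≡⟨ trans (cong (_* ((∣ A ∣ + 2) * p)) (∣S∣≡∑χ A)) (*-distribʳ-sum _ (χ A)) ⟨
    ∣ A ∣ * ((∣ A ∣ + 2) * p)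
      ∎
    where open ≤-Reasoning

  SumProductFree : Subset p → Subset p → Set
  SumProductFree A₁ A₂ = ∀ x y → addMod p x y ∈ A₁ → mulMod p x y ∉ A₂

  representations-vanish : ∀ {A₁ A₂} → SumProductFree A₁ A₂ → ∀ t → t ∈ A₂ → representations A₁ t ≡ 0
  representations-vanish {A₁} {A₂} free t t∈A₂ =
    trans (sum-cong-≗ {p} (λ s → ⟦⟧*≡0 (s ∈? A₁) (no-representation s))) (sum-replicate-zero p)
    where
    no-representation : ∀ s → s ∈ A₁ → fibre (splitProduct s) t ≡ 0
    no-representation s s∈A₁ = trans (sum-cong-≗ {p} (λ x → ⟦⟧≡0 (splitProduct s x ≟ t) (λ xy≡t →
        free x (subMod s x) (subst (_∈ A₁) (sym (addMod-subMod x s)) s∈A₁) (subst (_∈ A₂) (sym xy≡t) t∈A₂))))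
      (sum-replicate-zero p)

  sumProductFree⇒∣A₁∣*∣A₂∣≤2p : ∀ A₁ A₂ → SumProductFree A₁ A₂ → ∣ A₁ ∣ * ∣ A₂ ∣ ≤ 2 * p
  sumProductFree⇒∣A₁∣*∣A₂∣≤2p A₁ A₂ free =
    [a*n]²≤w*a*[a+2]*n⇒a*b≤2*n (∣ A₁ ∣) (∣ A₂ ∣) (∣ ∁ A₂ ∣) ∣∁A₂∣+∣A₂∣≡p (begin
    ∣ A₁ ∣ * p * (∣ A₁ ∣ * p)
      ≡⟨ cong₂ _*_ (∑-representations A₁) (∑-representations A₁) ⟨
    ∑[ t < p ] representations A₁ t * ∑[ t < p ] representations A₁ t
      ≤⟨ ∑²≤∣S∣*∑-square (∁ A₂) (representations A₁)
           (λ t t∉∁A₂ → representations-vanish free t (x∉∁p⇒x∈p t∉∁A₂)) ⟩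
    ∣ ∁ A₂ ∣ * ∑[ t < p ] (representations A₁ t * representations A₁ t)
      ≤⟨ *-monoʳ-≤ ∣ ∁ A₂ ∣ (∑-representations² A₁) ⟩
    ∣ ∁ A₂ ∣ * (∣ A₁ ∣ * ((∣ A₁ ∣ + 2) * p))
      ∎)
    where
    open ≤-Reasoning
    ∣∁A₂∣+∣A₂∣≡p : ∣ ∁ A₂ ∣ + ∣ A₂ ∣ ≡ p
    ∣∁A₂∣+∣A₂∣≡p = trans (cong (_+ ∣ A₂ ∣) (∣∁p∣≡n∸∣p∣ A₂)) (m∸n+n≡m (∣p∣≤n A₂))

mainTheorem4 : (p : ℕ) → (pp : Prime p) → (A₁ A₂ : Subset p) →
    ∣ A₁ ∣ * ∣ A₂ ∣ ≥ 20 * p →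
    ∃₂ λ (x y : Fin p) →
      addMod p {{prime⇒nonZero pp}} x y ∈ A₁ × mulMod p {{prime⇒nonZero pp}} x y ∈ A₂
mainTheorem4 p pp A₁ A₂ 20p≤∣A₁∣∣A₂∣ = decidable-stable solution? λ noSolution →
  <⇒≱ (*-monoˡ-< p 2<20)
    (≤-trans 20p≤∣A₁∣∣A₂∣ (sumProductFree⇒∣A₁∣*∣A₂∣≤2p A₁ A₂
      (λ x y x+y∈A₁ xy∈A₂ → noSolution (x , y , x+y∈A₁ , xy∈A₂))))
  where
  instance
    p≢0 : NonZero p
    p≢0 = prime⇒nonZero pp
  2<20 : 2 < 20
  2<20 = s≤s (s≤s (s≤s z≤n))
  2<p : 2 < p
  2<p = <-≤-trans 2<20 (*-cancelʳ-≤ 20 p p (≤-trans 20p≤∣A₁∣∣A₂∣ (*-mono-≤ (∣p∣≤n A₁) (∣p∣≤n A₂))))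
  open Representations p pp 2<p using (sumProductFree⇒∣A₁∣*∣A₂∣≤2p)
  solution? : Dec (∃₂ λ x y → addMod p x y ∈ A₁ × mulMod p x y ∈ A₂)
  solution? = any? λ x → any? λ y → addMod p x y ∈? A₁ ×-dec mulMod p x y ∈? A₂
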